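{- For all $n\geq 1$, the number of desarrangements of length $n$ avoiding each of $123$, $132$, and $213$ is $d_n(123,132,213)=f_{n-1}$, the $(n-1)$st Fibonacci number.
   Context: Permutations are in one-line notation. An index $i\in[n-1]$ is a descent of $\pi\in\mathfrak{S}_n$ if $\pi_i>\pi_{i+1}$; $i\in[n]$ is an ascent if it is not a descent (so $n$ is always an ascent). A desarrangement is a permutation whose first ascent is even. $d_n(\Pi)$ is the number of desarrangements in $\mathfrak{S}_n$ avoiding every pattern in $\Pi$ ($\pi$ avoids $\sigma$ if no subsequence of $\pi$ has the same relative order as $\sigma$). Fibonacci numbers: $f_0=0$, $f_1=1$, $f_n=f_{n-1}+f_{n-2}$ for $n\ge2$. -}

module Defs where

open import Data.Nat using (ℕ; zero; suc; _<ᵇ_; _≡ᵇ_)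
open import Data.Bool using (Bool; true; false; _∧_; _∨_; not; if_then_else_)
open import Data.List using (List; []; _∷_; map; concatMap; length; allFin; zip)
open import Data.Bool.ListAction using (all; any)
open import Data.Fin using (Fin; toℕ)
open import Data.Product using (_×_; _,_)

boolFilter : {A : Set} → (A → Bool) → List A → List A
boolFilter p [] = []
boolFilter p (x ∷ xs) = if p x then x ∷ boolFilter p xs else boolFilter p xs

fib : ℕ → ℕ
fib zero = 0
fib (suc zero) = 1
fib (suc (suc n)) = fib (suc n) Data.Nat.+ fib n

words : ℕ → ℕ → List (List ℕ)
words k zero = [] ∷ []
words k (suc m) = concatMap (λ i → map (toℕ i ∷_) (words k m)) (allFin k)

distinct : List ℕ → Bool
distinct [] = true
distinct (x ∷ xs) = not (any (x ≡ᵇ_) xs) ∧ distinct xs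

-- The permutations of length n in one-line notation (values 0,…,n-1; relative order
-- is all that matters for descents and pattern containment).
perms : ℕ → List (List ℕ)
perms n = boolFilter distinct (words n n)

subseqs : List ℕ → List (List ℕ)
subseqs [] = [] ∷ []
subseqs (x ∷ xs) = let r = subseqs xs in map (x ∷_) r Data.List.++ r

pairs : List ℕ → List (ℕ × ℕ)
pairs [] = []
pairs (x ∷ xs) = map (x ,_) xs Data.List.++ pairs xs

sameOrder : List ℕ → List ℕ → Bool
sameOrder s σ =
  (length s ≡ᵇ length σ) ∧
  all (λ { ((a , b) , (c , d)) → (a <ᵇ b) ≡ᵇᵇ (c <ᵇ d) }) (zip (pairs s) (pairs σ))
  where
  _≡ᵇᵇ_ : Bool → Bool → Bool
  true ≡ᵇᵇ y = y
  false ≡ᵇᵇ y = not y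

contains : List ℕ → List ℕ → Bool
contains π σ = any (λ s → sameOrder s σ) (subseqs π)

avoidsAll : List (List ℕ) → List ℕ → Bool
avoidsAll Π π = all (λ σ → not (contains π σ)) Π

-- 1-based position of the first ascent: index i (in [n-1]) with π_i < π_{i+1},
-- or n if there is none (n is always an ascent).
firstAscent : List ℕ → ℕ
firstAscent [] = 0
firstAscent (x ∷ []) = 1
firstAscent (x ∷ y ∷ ys) = if x <ᵇ y then 1 else suc (firstAscent (y ∷ ys))

even : ℕ → Bool
even zero = true
even (suc zero) = false
even (suc (suc n)) = even n

isDesarrangement : List ℕ → Bool
isDesarrangement π = even (firstAscent π)

d : ℕ → List (List ℕ) → ℕ
d n Π = length (boolFilter (λ π → isDesarrangement π ∧ avoidsAll Π π) (perms n))

module Submission where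

-- A triple x a b is an occurrence of 123, 132 or 213 exactly when x < b, so a permutation
-- avoiding all three has no entry smaller than an entry two or more places to its right.
-- Hence, by pigeonhole, a permutation of {0, …, n+1} of this kind starts either with
-- its maximum n+1 or with n followed by n+1, and deleting that prefix leaves an
-- arbitrary such permutation of {0, …, n} resp. {0, …, n-1}.  Prepending the maximum
-- creates a descent, which shifts the first ascent by one and swaps desarrangements
-- with non-desarrangements; the prefix n, n+1 is an ascent in position 1, so never a
-- desarrangement.  Writing D n and N n for the numbers of (non-)desarrangements,
--   D (n+2) = N (n+1)   and   N (n+2) = D (n+1) + D n + N n,
-- and induction gives D (n+1) = fib n and N (n+1) = fib (n+1).

open import Defs
open import Data.Nat
  using (ℕ; zero; suc; _+_; _≤_; _<_; _≤′_; ≤′-reflexive; ≤′-step; s≤s; s≤s⁻¹;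
         _<ᵇ_; _≡ᵇ_; _≤?_)
open import Data.Nat.Properties
open import Data.Nat.ListAction using (sum)
open import Data.Nat.ListAction.Properties using (sum-++)
open import Data.Bool using (Bool; true; false; T; not; _∧_; _∨_)
open import Data.Bool.Properties
  using (T-≡; T-∧; ∧-identityʳ; ∧-zeroʳ; ∧-assoc; ∨-assoc; ∨-idem; ∨-identityʳ;
         not-involutive; ∨-∧-booleanAlgebra)
open import Algebra.Lattice.Properties.BooleanAlgebra ∨-∧-booleanAlgebra using (deMorgan₂)
open import Data.Bool.Solver using (module ∨-∧-Solver)
open import Data.Bool.ListAction using (all; any)
open import Data.List
  using (List; []; _∷_; _++_; [_]; map; foldr; concatMap; length; allFin; tabulate;
         upTo; applyUpTo; lookup)
open import Data.List.Properties
  using (map-++; map-cong; map-cong-local; map-tabulate; map-upTo; upTo-∷ʳ)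
open import Data.List.Membership.Propositional using (_∈_)
open import Data.List.Membership.Propositional.Properties using (∈-concatMap⁻; ∈-map⁻; ∈-lookup)
open import Data.List.Relation.Unary.All as All using (All; []; _∷_)
open import Data.List.Relation.Unary.All.Properties using (all⁻; ¬Any⇒All¬)
open import Data.List.Relation.Unary.AllPairs using ([]; _∷_)
open import Data.List.Relation.Unary.Any as Any using (here; there)
open import Data.List.Relation.Unary.Any.Properties using (any⁺)
open import Data.List.Relation.Unary.Unique.Propositional using (Unique)
open import Data.Fin as Fin using (toℕ; fromℕ<)
import Data.Fin.Properties as Finₚ
open import Data.Product using (_×_; _,_; proj₁; proj₂)
open import Function using (_∘_; Equivalence)
open import Relation.Binary.Definitions using (tri<; tri≈; tri>)
open import Relation.Nullary using (¬_; contradiction; yes; no)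
open import Relation.Nullary.Reflects using (ofʸ; ofⁿ)
open import Relation.Binary.PropositionalEquality
  using (_≡_; _≢_; refl; sym; trans; cong; cong₂; subst; module ≡-Reasoning)

private
  variable
    A B : Set

¬T⇒≡false : ∀ {b} → ¬ T b → b ≡ false
¬T⇒≡false {false} _  = refl
¬T⇒≡false {true}  ¬t = contradiction _ ¬t

T-not⇒¬T : ∀ {b} → T (not b) → ¬ T b
T-not⇒¬T {false} _ ()

<ᵇ-true : ∀ {m n} → m < n → (m <ᵇ n) ≡ true
<ᵇ-true m<n = Equivalence.to T-≡ (<⇒<ᵇ m<n)

<ᵇ-false : ∀ {m n} → n ≤ m → (m <ᵇ n) ≡ false
<ᵇ-false {m} {n} n≤m = ¬T⇒≡false (≤⇒≯ n≤m ∘ <ᵇ⇒< m n)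

≡ᵇ-refl : ∀ n → (n ≡ᵇ n) ≡ true
≡ᵇ-refl n = Equivalence.to T-≡ (≡⇒≡ᵇ n n refl)

≡ᵇ-false : ∀ {m n} → m ≢ n → (m ≡ᵇ n) ≡ false
≡ᵇ-false {m} {n} m≢n = ¬T⇒≡false (m≢n ∘ ≡ᵇ⇒≡ m n)

not-≡ᵇ∧not-<ᵇ : ∀ n z → not (n ≡ᵇ z) ∧ not (n <ᵇ z) ≡ (z <ᵇ n)
not-≡ᵇ∧not-<ᵇ n z with <-cmp z n
... | tri< z<n _ _ rewrite ≡ᵇ-false (>⇒≢ z<n) | <ᵇ-false (<⇒≤ z<n) | <ᵇ-true z<n = refl
... | tri≈ _ refl _ rewrite ≡ᵇ-refl z | <ᵇ-false (≤-refl {z}) = refl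
... | tri> _ _ n<z rewrite ≡ᵇ-false (<⇒≢ n<z) | <ᵇ-true n<z | <ᵇ-false (<⇒≤ n<z) = refl

not-≡ᵇ-≤ : ∀ {k z} → z ≤ k → not (k ≡ᵇ z) ≡ (z <ᵇ k)
not-≡ᵇ-≤ {k} {z} z≤k = begin
  not (k ≡ᵇ z)                      ≡⟨ ∧-identityʳ _ ⟨
  not (k ≡ᵇ z) ∧ true               ≡⟨ cong (λ b → not (k ≡ᵇ z) ∧ not b) (<ᵇ-false z≤k) ⟨
  not (k ≡ᵇ z) ∧ not (k <ᵇ z)       ≡⟨ not-≡ᵇ∧not-<ᵇ k z ⟩
  z <ᵇ k                            ∎
  where open ≡-Reasoning

∨-interchange : ∀ a b c d → (a ∨ b) ∨ (c ∨ d) ≡ (a ∨ c) ∨ (b ∨ d)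
∨-interchange = solve 4 (λ a b c d → (a :+ b) :+ (c :+ d) := (a :+ c) :+ (b :+ d)) refl
  where open ∨-∧-Solver

∧-interchange : ∀ a b c d → (a ∧ b) ∧ (c ∧ d) ≡ (a ∧ c) ∧ (b ∧ d)
∧-interchange = solve 4 (λ a b c d → (a :* b) :* (c :* d) := (a :* c) :* (b :* d)) refl
  where open ∨-∧-Solver

any-++ : ∀ (p : A → Bool) xs ys → any p (xs ++ ys) ≡ any p xs ∨ any p ys
any-++ p []       ys = refl
any-++ p (x ∷ xs) ys = trans (cong (p x ∨_) (any-++ p xs ys)) (sym (∨-assoc (p x) _ _))

any-map : ∀ (p : B → Bool) (f : A → B) xs → any p (map f xs) ≡ any (p ∘ f) xs
any-map p f []       = refl
any-map p f (x ∷ xs) = cong (p (f x) ∨_) (any-map p f xs)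

any-cong : ∀ {p q : A → Bool} xs → (∀ x → p x ≡ q x) → any p xs ≡ any q xs
any-cong xs p≗q = cong (foldr _∨_ false) (map-cong p≗q xs)

any-false : ∀ {p : A → Bool} {xs} → All (λ x → p x ≡ false) xs → any p xs ≡ false
any-false []           = refl
any-false (px≡f ∷ pxs) rewrite px≡f = any-false pxs

any-∨ : ∀ (p q : A → Bool) xs → any (λ x → p x ∨ q x) xs ≡ any p xs ∨ any q xs
any-∨ p q []       = refl
any-∨ p q (x ∷ xs) = trans (cong ((p x ∨ q x) ∨_) (any-∨ p q xs)) (∨-interchange (p x) (q x) _ _)

all-cong : ∀ {p q : A → Bool} {xs} → All (λ x → p x ≡ q x) xs → all p xs ≡ all q xs
all-cong p≗q = cong (foldr _∧_ true) (map-cong-local p≗q)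

not-any : ∀ (p : A → Bool) xs → not (any p xs) ≡ all (not ∘ p) xs
not-any p []       = refl
not-any p (x ∷ xs) = trans (deMorgan₂ (p x) (any p xs)) (cong (not (p x) ∧_) (not-any p xs))

all-∧ : ∀ (p q : A → Bool) xs → all p xs ∧ all q xs ≡ all (λ x → p x ∧ q x) xs
all-∧ p q []       = refl
all-∧ p q (x ∷ xs) = trans (∧-interchange (p x) _ (q x) _) (cong ((p x ∧ q x) ∧_) (all-∧ p q xs))

none⇒All¬ : ∀ (p : A → Bool) xs → T (not (any p xs)) → All (λ x → ¬ T (p x)) xs
none⇒All¬ p xs none = ¬Any⇒All¬ xs (T-not⇒¬T none ∘ any⁺ p)

anyPair : (A → A → Bool) → List A → Bool
anyPair h []      = false
anyPair h (a ∷ v) = any (h a) v ∨ anyPair h v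

anyPair-cong : ∀ {f g : A → A → Bool} v → (∀ a b → f a b ≡ g a b) → anyPair f v ≡ anyPair g v
anyPair-cong []      f≗g = refl
anyPair-cong (a ∷ v) f≗g = cong₂ _∨_ (any-cong v (f≗g a)) (anyPair-cong v f≗g)

anyPair-false : ∀ (v : List A) → anyPair (λ _ _ → false) v ≡ false
anyPair-false []      = refl
anyPair-false (a ∷ v) = cong₂ _∨_ (any-false (All.universal (λ _ → refl) v)) (anyPair-false v)

anyPair-∨ : ∀ (f g : A → A → Bool) v →
            anyPair (λ a b → f a b ∨ g a b) v ≡ anyPair f v ∨ anyPair g v
anyPair-∨ f g []      = refl
anyPair-∨ f g (a ∷ v) = begin
  any (λ b → f a b ∨ g a b) v ∨ anyPair (λ a b → f a b ∨ g a b) v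
    ≡⟨ cong₂ _∨_ (any-∨ (f a) (g a) v) (anyPair-∨ f g v) ⟩
  (any (f a) v ∨ any (g a) v) ∨ (anyPair f v ∨ anyPair g v)
    ≡⟨ ∨-interchange (any (f a) v) _ _ _ ⟩
  (any (f a) v ∨ anyPair f v) ∨ (any (g a) v ∨ anyPair g v)
    ∎
  where open ≡-Reasoning

anyPair-second : ∀ (g : A → Bool) y w → anyPair (λ _ b → g b) (y ∷ w) ≡ any g w
anyPair-second g y []      = refl
anyPair-second g y (z ∷ w) = begin
  (g z ∨ any g w) ∨ anyPair (λ _ b → g b) (z ∷ w)
    ≡⟨ cong ((g z ∨ any g w) ∨_) (anyPair-second g z w) ⟩
  (g z ∨ any g w) ∨ any g w  ≡⟨ ∨-assoc (g z) _ _ ⟩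
  g z ∨ (any g w ∨ any g w)  ≡⟨ cong (g z ∨_) (∨-idem _) ⟩
  g z ∨ any g w              ∎
  where open ≡-Reasoning

count : (A → Bool) → List A → ℕ
count p xs = length (boolFilter p xs)

count-++ : ∀ (p : A → Bool) xs ys → count p (xs ++ ys) ≡ count p xs + count p ys
count-++ p []       ys = refl
count-++ p (x ∷ xs) ys with p x
... | true  = cong suc (count-++ p xs ys)
... | false = count-++ p xs ys

count-map : ∀ (p : B → Bool) (f : A → B) xs → count p (map f xs) ≡ count (p ∘ f) xs
count-map p f []       = refl
count-map p f (x ∷ xs) with p (f x)
... | true  = cong suc (count-map p f xs)
... | false = count-map p f xs

count-concatMap : ∀ (p : B → Bool) (f : A → List B) xs →
                  count p (concatMap f xs) ≡ sum (map (count p ∘ f) xs)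
count-concatMap p f []       = refl
count-concatMap p f (x ∷ xs) =
  trans (count-++ p (f x) (concatMap f xs)) (cong (count p (f x) +_) (count-concatMap p f xs))

count-cong : ∀ {p q : A → Bool} xs → (∀ {x} → x ∈ xs → p x ≡ q x) → count p xs ≡ count q xs
count-cong []                   _     = refl
count-cong {p = p} {q} (x ∷ xs) p≗q rewrite p≗q (here refl) with q x
... | true  = cong suc (count-cong xs (p≗q ∘ there))
... | false = count-cong xs (p≗q ∘ there)

count-zero : ∀ {p : A → Bool} xs → (∀ {x} → x ∈ xs → p x ≡ false) → count p xs ≡ 0
count-zero []       _    = refl
count-zero (x ∷ xs) none rewrite none (here refl) = count-zero xs (none ∘ there)

count-split : ∀ (p q : A → Bool) xs →
              count p xs ≡ count (λ x → p x ∧ q x) xs + count (λ x → p x ∧ not (q x)) xs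
count-split p q []       = refl
count-split p q (x ∷ xs) with p x | q x
... | true  | true  = cong suc (count-split p q xs)
... | true  | false = trans (cong suc (count-split p q xs)) (sym (+-suc _ _))
... | false | _     = count-split p q xs

count-boolFilter : ∀ (p q : A → Bool) xs → count p (boolFilter q xs) ≡ count (λ x → q x ∧ p x) xs
count-boolFilter p q []       = refl
count-boolFilter p q (x ∷ xs) with q x
... | false = count-boolFilter p q xs
... | true with p x
...   | true  = cong suc (count-boolFilter p q xs)
...   | false = count-boolFilter p q xs

sum-upTo-suc : ∀ (f : ℕ → ℕ) k → sum (map f (upTo (suc k))) ≡ sum (map f (upTo k)) + f k
sum-upTo-suc f k = begin
  sum (map f (upTo (suc k)))        ≡⟨ cong (sum ∘ map f) (upTo-∷ʳ k) ⟨
  sum (map f (upTo k ++ [ k ]))     ≡⟨ cong sum (map-++ f (upTo k) [ k ]) ⟩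
  sum (map f (upTo k) ++ [ f k ])   ≡⟨ sum-++ (map f (upTo k)) [ f k ] ⟩
  sum (map f (upTo k)) + (f k + 0)  ≡⟨ cong (sum (map f (upTo k)) +_) (+-identityʳ (f k)) ⟩
  sum (map f (upTo k)) + f k        ∎
  where open ≡-Reasoning

sum-upTo-cong : ∀ (f g : ℕ → ℕ) k → (∀ i → i < k → f i ≡ g i) →
                sum (map f (upTo k)) ≡ sum (map g (upTo k))
sum-upTo-cong f g zero    _   = refl
sum-upTo-cong f g (suc k) f≗g = begin
  sum (map f (upTo (suc k)))  ≡⟨ sum-upTo-suc f k ⟩
  sum (map f (upTo k)) + f k  ≡⟨ cong₂ _+_ (sum-upTo-cong f g k (λ i → f≗g i ∘ m<n⇒m<1+n))
                                           (f≗g k (n<1+n k)) ⟩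
  sum (map g (upTo k)) + g k  ≡⟨ sum-upTo-suc g k ⟨
  sum (map g (upTo (suc k)))  ∎
  where open ≡-Reasoning

sum-upTo-zero : ∀ (f : ℕ → ℕ) k → (∀ i → i < k → f i ≡ 0) → sum (map f (upTo k)) ≡ 0
sum-upTo-zero f zero    _   = refl
sum-upTo-zero f (suc k) f≡0 =
  trans (sum-upTo-suc f k)
        (cong₂ _+_ (sum-upTo-zero f k (λ i → f≡0 i ∘ m<n⇒m<1+n)) (f≡0 k (n<1+n k)))

sum-upTo-last-two : ∀ (f : ℕ → ℕ) n → (∀ i → i < n → f i ≡ 0) →
                    sum (map f (upTo (2 + n))) ≡ f n + f (suc n)
sum-upTo-last-two f n f≡0 = begin
  sum (map f (upTo (2 + n)))              ≡⟨ sum-upTo-suc f (suc n) ⟩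
  sum (map f (upTo (suc n))) + f (suc n)  ≡⟨ cong (_+ f (suc n)) (sum-upTo-suc f n) ⟩
  sum (map f (upTo n)) + f n + f (suc n)  ≡⟨ cong (λ s → s + f n + f (suc n)) (sum-upTo-zero f n f≡0) ⟩
  f n + f (suc n)                         ∎
  where open ≡-Reasoning

sum-upTo-truncate : ∀ (f : ℕ → ℕ) {k l} → (∀ i → k ≤ i → f i ≡ 0) → k ≤′ l →
                    sum (map f (upTo l)) ≡ sum (map f (upTo k))
sum-upTo-truncate f     f≡0 (≤′-reflexive refl)        = refl
sum-upTo-truncate f {k} f≡0 (≤′-step {l} k≤′l) = begin
  sum (map f (upTo (suc l)))  ≡⟨ sum-upTo-suc f l ⟩
  sum (map f (upTo l)) + f l  ≡⟨ cong₂ _+_ (sum-upTo-truncate f f≡0 k≤′l) (f≡0 l (≤′⇒≤ k≤′l)) ⟩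
  sum (map f (upTo k)) + 0    ≡⟨ +-identityʳ _ ⟩
  sum (map f (upTo k))        ∎
  where open ≡-Reasoning

tabulate-toℕ : ∀ k (f : ℕ → A) → tabulate {n = k} (f ∘ toℕ) ≡ applyUpTo f k
tabulate-toℕ zero    f = refl
tabulate-toℕ (suc k) f = cong (f 0 ∷_) (tabulate-toℕ k (f ∘ suc))

map-allFin : ∀ k (f : ℕ → A) → map (f ∘ toℕ) (allFin k) ≡ map f (upTo k)
map-allFin k f =
  trans (map-tabulate (λ i → i) (f ∘ toℕ)) (trans (tabulate-toℕ k f) (sym (map-upTo f k)))

count-words-suc : ∀ k m (P : List ℕ → Bool) →
                  count P (words k (suc m)) ≡
                  sum (map (λ i → count (P ∘ (i ∷_)) (words k m)) (upTo k))
count-words-suc k m P = begin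
  count P (concatMap (λ i → map (toℕ i ∷_) (words k m)) (allFin k))
    ≡⟨ count-concatMap P _ (allFin k) ⟩
  sum (map (λ i → count P (map (toℕ i ∷_) (words k m))) (allFin k))
    ≡⟨ cong sum (map-allFin k (λ i → count P (map (i ∷_) (words k m)))) ⟩
  sum (map (λ i → count P (map (i ∷_) (words k m))) (upTo k))
    ≡⟨ cong sum (map-cong (λ i → count-map P (i ∷_) (words k m)) (upTo k)) ⟩
  sum (map (λ i → count (P ∘ (i ∷_)) (words k m)) (upTo k))
    ∎
  where open ≡-Reasoning

∈-words⁻ : ∀ k m {w} → w ∈ words k m → length w ≡ m × All (_< k) w
∈-words⁻ k zero    (here refl) = refl , []
∈-words⁻ k (suc m) w∈
  with i , w∈′ ← Any.satisfied (∈-concatMap⁻ (λ i → map (toℕ i ∷_) (words k m)) {xs = allFin k} w∈)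
  with v , v∈ , refl ← ∈-map⁻ (toℕ i ∷_) w∈′
  with |v|≡m , v<k ← ∈-words⁻ k m v∈
  = cong suc |v|≡m , Finₚ.toℕ<n i ∷ v<k

count-words-restrict : ∀ {k l} m (P : List ℕ → Bool) → k ≤ l →
                       count (λ w → all (_<ᵇ k) w ∧ P w) (words l m) ≡ count P (words k m)
count-words-restrict         zero    P _   = refl
count-words-restrict {k} {l} (suc m) P k≤l = begin
  count (λ w → all (_<ᵇ k) w ∧ P w) (words l (suc m))
    ≡⟨ count-words-suc l m _ ⟩
  sum (map first (upTo l))
    ≡⟨ sum-upTo-truncate first large (≤⇒≤′ k≤l) ⟩
  sum (map first (upTo k))
    ≡⟨ sum-upTo-cong first _ k small ⟩
  sum (map (λ i → count (P ∘ (i ∷_)) (words k m)) (upTo k))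
    ≡⟨ count-words-suc k m P ⟨
  count P (words k (suc m))
    ∎
  where
  open ≡-Reasoning
  -- all (_<ᵇ k) (i ∷ w) is written unfolded, so that rewriting with i <ᵇ k applies.
  first : ℕ → ℕ
  first i = count (λ w → ((i <ᵇ k) ∧ all (_<ᵇ k) w) ∧ P (i ∷ w)) (words l m)
  large : ∀ i → k ≤ i → count (λ w → ((i <ᵇ k) ∧ all (_<ᵇ k) w) ∧ P (i ∷ w)) (words l m) ≡ 0
  large i k≤i rewrite <ᵇ-false k≤i = count-zero (words l m) (λ _ → refl)
  small : ∀ i → i < k → count (λ w → ((i <ᵇ k) ∧ all (_<ᵇ k) w) ∧ P (i ∷ w)) (words l m) ≡
                        count (P ∘ (i ∷_)) (words k m)
  small i i<k rewrite <ᵇ-true i<k = count-words-restrict m (P ∘ (i ∷_)) k≤l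

-- Pigeonhole principle for lists

distinct⇒Unique : ∀ v → T (distinct v) → Unique v
distinct⇒Unique []      _ = []
distinct⇒Unique (x ∷ v) d with x∉v , dv ← Equivalence.to T-∧ d =
  All.map (λ {z} x≢ᵇz x≡z → x≢ᵇz (≡⇒≡ᵇ x z x≡z)) (none⇒All¬ (x ≡ᵇ_) v x∉v) ∷ distinct⇒Unique v dv

Unique-lookup-injective : ∀ {xs : List A} → Unique xs → ∀ {i j} → lookup xs i ≡ lookup xs j → i ≡ j
Unique-lookup-injective (_  ∷ _) {Fin.zero}  {Fin.zero}  _  = refl
Unique-lookup-injective (x≢ ∷ _) {Fin.zero}  {Fin.suc j} x≡ = contradiction x≡ (All.lookup x≢ (∈-lookup j))
Unique-lookup-injective (x≢ ∷ _) {Fin.suc i} {Fin.zero}  ≡x = contradiction (sym ≡x) (All.lookup x≢ (∈-lookup i))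
Unique-lookup-injective (_  ∷ u) {Fin.suc i} {Fin.suc j} eq = cong Fin.suc (Unique-lookup-injective u eq)

Unique⇒length≤ : ∀ {k} v → Unique v → All (_< k) v → length v ≤ k
Unique⇒length≤ {k} v u v<k with length v ≤? k
... | yes |v|≤k = |v|≤k
... | no  |v|≰k
  with i , j , i<j , same ← Finₚ.pigeonhole (≰⇒> |v|≰k) (λ i → fromℕ< (All.lookup v<k (∈-lookup i)))
  = contradiction (Unique-lookup-injective u (Finₚ.fromℕ<-injective _ _ _ _ same)) (Finₚ.<⇒≢ i<j)

-- Containment of patterns of length three

any-subseqs-∷ : ∀ (p : List ℕ → Bool) x v →
                any p (subseqs (x ∷ v)) ≡ any (p ∘ (x ∷_)) (subseqs v) ∨ any p (subseqs v)
any-subseqs-∷ p x v =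
  trans (any-++ p (map (x ∷_) (subseqs v)) (subseqs v))
        (cong (_∨ any p (subseqs v)) (any-map p (x ∷_) (subseqs v)))

nilWith : Bool → List ℕ → Bool
nilWith c []      = c
nilWith c (_ ∷ _) = false

singletonWith : (ℕ → Bool) → List ℕ → Bool
singletonWith g (b ∷ []) = g b
singletonWith g _        = false

pairWith : (ℕ → ℕ → Bool) → List ℕ → Bool
pairWith h (a ∷ b ∷ []) = h a b
pairWith h _            = false

singletonWith-∷ : ∀ g a s → singletonWith g (a ∷ s) ≡ nilWith (g a) s
singletonWith-∷ g a []      = refl
singletonWith-∷ g a (_ ∷ _) = refl

pairWith-∷ : ∀ h a s → pairWith h (a ∷ s) ≡ singletonWith (h a) s
pairWith-∷ h a []          = refl
pairWith-∷ h a (_ ∷ [])    = refl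
pairWith-∷ h a (_ ∷ _ ∷ _) = refl

any-subseqs-nilWith : ∀ c v → any (nilWith c) (subseqs v) ≡ c
any-subseqs-nilWith c []      = ∨-identityʳ c
any-subseqs-nilWith c (a ∷ v) =
  trans (any-subseqs-∷ (nilWith c) a v)
        (cong₂ _∨_ (any-false (All.universal (λ _ → refl) (subseqs v))) (any-subseqs-nilWith c v))

any-subseqs-singletonWith : ∀ g v → any (singletonWith g) (subseqs v) ≡ any g v
any-subseqs-singletonWith g []      = refl
any-subseqs-singletonWith g (a ∷ v) =
  trans (any-subseqs-∷ (singletonWith g) a v)
        (cong₂ _∨_ (trans (any-cong (subseqs v) (singletonWith-∷ g a)) (any-subseqs-nilWith (g a) v))
                   (any-subseqs-singletonWith g v))

any-subseqs-pairWith : ∀ h v → any (pairWith h) (subseqs v) ≡ anyPair h v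
any-subseqs-pairWith h []      = refl
any-subseqs-pairWith h (a ∷ v) =
  trans (any-subseqs-∷ (pairWith h) a v)
        (cong₂ _∨_ (trans (any-cong (subseqs v) (pairWith-∷ h a)) (any-subseqs-singletonWith (h a) v))
                   (any-subseqs-pairWith h v))

sameOrder-∷ : ∀ σ x s → length σ ≡ 3 →
              sameOrder (x ∷ s) σ ≡ pairWith (λ a b → sameOrder (x ∷ a ∷ b ∷ []) σ) s
sameOrder-∷ (_ ∷ _ ∷ _ ∷ []) x []              refl = refl
sameOrder-∷ (_ ∷ _ ∷ _ ∷ []) x (_ ∷ [])        refl = refl
sameOrder-∷ (_ ∷ _ ∷ _ ∷ []) x (_ ∷ _ ∷ [])    refl = refl
sameOrder-∷ (_ ∷ _ ∷ _ ∷ []) x (_ ∷ _ ∷ _ ∷ _) refl = refl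

contains-∷ : ∀ σ x v → length σ ≡ 3 →
             contains (x ∷ v) σ ≡ anyPair (λ a b → sameOrder (x ∷ a ∷ b ∷ []) σ) v ∨ contains v σ
contains-∷ σ x v |σ|≡3 =
  trans (any-subseqs-∷ (λ s → sameOrder s σ) x v)
        (cong (_∨ contains v σ)
              (trans (any-cong (subseqs v) (λ s → sameOrder-∷ σ x s |σ|≡3)) (any-subseqs-pairWith _ v)))

avoidsAll-∷ : ∀ {patterns} x v → All (λ σ → length σ ≡ 3) patterns →
              avoidsAll patterns (x ∷ v) ≡
              avoidsAll patterns v ∧ not (anyPair (λ a b → any (sameOrder (x ∷ a ∷ b ∷ [])) patterns) v)
avoidsAll-∷ x v [] = cong not (sym (anyPair-false v))
avoidsAll-∷ {σ ∷ patterns} x v (|σ|≡3 ∷ |patterns|≡3) = begin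
  not (contains (x ∷ v) σ) ∧ avoidsAll patterns (x ∷ v)
    ≡⟨ cong₂ (λ c a → not c ∧ a) (contains-∷ σ x v |σ|≡3) (avoidsAll-∷ x v |patterns|≡3) ⟩
  not (anyPair onσ v ∨ contains v σ) ∧ (avoidsAll patterns v ∧ not (anyPair onRest v))
    ≡⟨ regroup (anyPair onσ v) (contains v σ) (avoidsAll patterns v) (anyPair onRest v) ⟩
  (not (contains v σ) ∧ avoidsAll patterns v) ∧ not (anyPair onσ v ∨ anyPair onRest v)
    ≡⟨ cong (λ b → (not (contains v σ) ∧ avoidsAll patterns v) ∧ not b) (anyPair-∨ onσ onRest v) ⟨
  (not (contains v σ) ∧ avoidsAll patterns v) ∧ not (anyPair (λ a b → onσ a b ∨ onRest a b) v)
    ∎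
  where
  open ≡-Reasoning
  onσ onRest : ℕ → ℕ → Bool
  onσ    a b = sameOrder (x ∷ a ∷ b ∷ []) σ
  onRest a b = any (sameOrder (x ∷ a ∷ b ∷ [])) patterns
  regroup : ∀ a c r b → not (a ∨ c) ∧ (r ∧ not b) ≡ (not c ∧ r) ∧ not (a ∨ b)
  regroup false false r b = refl
  regroup false true  r b = refl
  regroup true  c     r b = sym (∧-zeroʳ _)

-- Avoiders of 123, 132 and 213

Π : List (List ℕ)
Π = (1 ∷ 2 ∷ 3 ∷ []) ∷ (1 ∷ 3 ∷ 2 ∷ []) ∷ (2 ∷ 1 ∷ 3 ∷ []) ∷ []

avoidsΠ : List ℕ → Bool
avoidsΠ = avoidsAll Π

Π-occurrence : ∀ x a b → any (sameOrder (x ∷ a ∷ b ∷ [])) Π ≡ (x <ᵇ b)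
Π-occurrence x a b
  with x <ᵇ a | <ᵇ-reflects-< x a | x <ᵇ b | <ᵇ-reflects-< x b | a <ᵇ b | <ᵇ-reflects-< a b
... | true  | _        | true  | _       | true  | _        = refl
... | true  | _        | true  | _       | false | _        = refl
... | true  | _        | false | _       | true  | _        = refl
... | true  | _        | false | _       | false | _        = refl
... | false | _        | true  | _       | true  | _        = refl
... | false | ofⁿ x≮a  | true  | ofʸ x<b | false | ofⁿ a≮b  =
  contradiction x<b (≤⇒≯ (≤-trans (≮⇒≥ a≮b) (≮⇒≥ x≮a)))
... | false | _        | false | _       | true  | _        = refl
... | false | _        | false | _       | false | _        = refl

avoidsΠ-∷∷ : ∀ x y w → avoidsΠ (x ∷ y ∷ w) ≡ avoidsΠ (y ∷ w) ∧ not (any (x <ᵇ_) w)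
avoidsΠ-∷∷ x y w =
  trans (avoidsAll-∷ {Π} x (y ∷ w) (refl ∷ refl ∷ refl ∷ []))
        (cong (λ b → avoidsΠ (y ∷ w) ∧ not b)
              (trans (anyPair-cong (y ∷ w) (Π-occurrence x)) (anyPair-second (x <ᵇ_) y w)))

isAvoider : List ℕ → Bool
isAvoider w = distinct w ∧ avoidsΠ w

isAvoider⁻ : ∀ {v} → T (isAvoider v) → T (distinct v) × T (avoidsΠ v)
isAvoider⁻ {v} = Equivalence.to (T-∧ {distinct v} {avoidsΠ v})

isAvoider⇒Unique : ∀ {v} → T (isAvoider v) → Unique v
isAvoider⇒Unique {v} t = distinct⇒Unique v (proj₁ (isAvoider⁻ {v} t))

isAvoider⇒tail≤head : ∀ x y w → T (isAvoider (x ∷ y ∷ w)) → All (_≤ x) w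
isAvoider⇒tail≤head x y w t =
  All.map (λ x≮ᵇz → ≮⇒≥ (x≮ᵇz ∘ <⇒<ᵇ)) (none⇒All¬ (x <ᵇ_) w nothing-above)
  where
  nothing-above : T (not (any (x <ᵇ_) w))
  nothing-above = proj₂ (Equivalence.to (T-∧ {avoidsΠ (y ∷ w)})
                          (subst T (avoidsΠ-∷∷ x y w) (proj₂ (isAvoider⁻ {x ∷ y ∷ w} t))))

isAvoider⇒length≤head : ∀ {x y w} → T (isAvoider (x ∷ y ∷ w)) → length w ≤ x
isAvoider⇒length≤head {x} {y} {w} t with (_ ∷ x∉w) ∷ (_ ∷ uw) ← isAvoider⇒Unique {x ∷ y ∷ w} t =
  s≤s⁻¹ (Unique⇒length≤ (x ∷ w) (x∉w ∷ uw) (n<1+n x ∷ All.map s≤s (isAvoider⇒tail≤head x y w t)))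

isAvoider⇒length<head : ∀ {x y w} → T (isAvoider (x ∷ y ∷ w)) → y ≤ x → length w < x
isAvoider⇒length<head {x} {y} {w} t y≤x =
  s≤s⁻¹ (Unique⇒length≤ (x ∷ y ∷ w) (isAvoider⇒Unique t)
                         (n<1+n x ∷ s≤s y≤x ∷ All.map s≤s (isAvoider⇒tail≤head x y w t)))

isAvoider-∷∷ : ∀ x y w → isAvoider (x ∷ y ∷ w) ≡
               (not (any (x ≡ᵇ_) (y ∷ w)) ∧ not (any (x <ᵇ_) w)) ∧ isAvoider (y ∷ w)
isAvoider-∷∷ x y w =
  trans (cong (distinct (x ∷ y ∷ w) ∧_) (avoidsΠ-∷∷ x y w))
        (rearrange (not (any (x ≡ᵇ_) (y ∷ w))) (distinct (y ∷ w)) (avoidsΠ (y ∷ w))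
                   (not (any (x <ᵇ_) w)))
  where
  rearrange : ∀ a b c d → (a ∧ b) ∧ (c ∧ d) ≡ (a ∧ d) ∧ (b ∧ c)
  rearrange = solve 4 (λ a b c d → (a :* b) :* (c :* d) := (a :* d) :* (b :* c)) refl
    where open ∨-∧-Solver

isAvoider-top : ∀ {k} v → All (_≤ k) v → isAvoider (k ∷ v) ≡ all (_<ᵇ k) v ∧ isAvoider v
isAvoider-top     []      []              = refl
isAvoider-top {k} (y ∷ w) v≤k@(_ ∷ w≤k) = begin
  isAvoider (k ∷ y ∷ w)
    ≡⟨ isAvoider-∷∷ k y w ⟩
  (not (any (k ≡ᵇ_) (y ∷ w)) ∧ not (any (k <ᵇ_) w)) ∧ isAvoider (y ∷ w)
    ≡⟨ cong₂ (λ a b → (a ∧ not b) ∧ isAvoider (y ∷ w))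
             (trans (not-any (k ≡ᵇ_) (y ∷ w)) (all-cong (All.map not-≡ᵇ-≤ v≤k)))
             (any-false (All.map <ᵇ-false w≤k)) ⟩
  (all (_<ᵇ k) (y ∷ w) ∧ true) ∧ isAvoider (y ∷ w)
    ≡⟨ cong (_∧ isAvoider (y ∷ w)) (∧-identityʳ (all (_<ᵇ k) (y ∷ w))) ⟩
  all (_<ᵇ k) (y ∷ w) ∧ isAvoider (y ∷ w)
    ∎
  where open ≡-Reasoning

isAvoider-below : ∀ {k v} → All (_< k) v → isAvoider (k ∷ v) ≡ isAvoider v
isAvoider-below {k} {v} v<k =
  trans (isAvoider-top v (All.map <⇒≤ v<k))
        (cong (_∧ isAvoider v) (Equivalence.to T-≡ (all⁻ (_<ᵇ k) (All.map <⇒<ᵇ v<k))))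

isAvoider-rise : ∀ n w → isAvoider (n ∷ suc n ∷ w) ≡ all (_<ᵇ n) w ∧ isAvoider (suc n ∷ w)
isAvoider-rise n w = trans (isAvoider-∷∷ n (suc n) w) (cong (_∧ isAvoider (suc n ∷ w)) below-n)
  where
  open ≡-Reasoning
  below-n : not ((n ≡ᵇ suc n) ∨ any (n ≡ᵇ_) w) ∧ not (any (n <ᵇ_) w) ≡ all (_<ᵇ n) w
  below-n rewrite ≡ᵇ-false (<⇒≢ (n<1+n n)) = begin
    not (any (n ≡ᵇ_) w) ∧ not (any (n <ᵇ_) w)          ≡⟨ cong₂ _∧_ (not-any (n ≡ᵇ_) w) (not-any (n <ᵇ_) w) ⟩
    all (not ∘ (n ≡ᵇ_)) w ∧ all (not ∘ (n <ᵇ_)) w      ≡⟨ all-∧ (not ∘ (n ≡ᵇ_)) (not ∘ (n <ᵇ_)) w ⟩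
    all (λ z → not (n ≡ᵇ z) ∧ not (n <ᵇ z)) w          ≡⟨ all-cong (All.universal (not-≡ᵇ∧not-<ᵇ n) w) ⟩
    all (_<ᵇ n) w                                      ∎

even-suc : ∀ m → even (suc m) ≡ not (even m)
even-suc zero    = refl
even-suc (suc m) = trans (sym (not-involutive (even m))) (cong not (sym (even-suc m)))

isDesarrangement-descent : ∀ {x y} w → y ≤ x →
                           isDesarrangement (x ∷ y ∷ w) ≡ not (isDesarrangement (y ∷ w))
isDesarrangement-descent w y≤x rewrite <ᵇ-false y≤x = even-suc (firstAscent (_ ∷ w))

isDesarrangement-ascent : ∀ {x y} w → x < y → isDesarrangement (x ∷ y ∷ w) ≡ false
isDesarrangement-ascent w x<y rewrite <ᵇ-true x<y = refl

isDesarrangement-after-max : ∀ {n v} → length v ≡ suc n → All (_< suc n) v →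
                             isDesarrangement (suc n ∷ v) ≡ not (isDesarrangement v)
isDesarrangement-after-max {v = y ∷ w} _ (y<1+n ∷ _) = isDesarrangement-descent w (<⇒≤ y<1+n)

-- The recurrence

countAvoiders : (List ℕ → Bool) → ℕ → ℕ
countAvoiders Q n = count (λ w → isAvoider w ∧ Q w) (words n n)

countAvoiders-cong : ∀ {Q R} n → (∀ {w} → length w ≡ n → All (_< n) w → Q w ≡ R w) →
                     countAvoiders Q n ≡ countAvoiders R n
countAvoiders-cong n Q≗R = count-cong (words n n) λ {w} w∈ →
  cong (isAvoider w ∧_) (Q≗R (proj₁ (∈-words⁻ n n w∈)) (proj₂ (∈-words⁻ n n w∈)))

countAvoiders-false : ∀ n → countAvoiders (λ _ → false) n ≡ 0
countAvoiders-false n = count-zero (words n n) (λ {w} _ → ∧-zeroʳ (isAvoider w))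

countAvoiders-split : ∀ Q n →
                      countAvoiders (λ _ → true) n ≡ countAvoiders Q n + countAvoiders (not ∘ Q) n
countAvoiders-split Q n =
  trans (count-cong (words n n) (λ {w} _ → ∧-identityʳ (isAvoider w)))
        (count-split isAvoider Q (words n n))

count-after-max : ∀ (Q : List ℕ → Bool) n →
  count (λ v → isAvoider (suc n ∷ v) ∧ Q (suc n ∷ v)) (words (2 + n) (suc n)) ≡
  countAvoiders (λ v → Q (suc n ∷ v)) (suc n)
count-after-max Q n = begin
  count (λ v → isAvoider (suc n ∷ v) ∧ Q (suc n ∷ v)) (words (2 + n) (suc n))
    ≡⟨ count-cong (words (2 + n) (suc n)) (λ {v} v∈ →
         let v≤1+n = All.map s≤s⁻¹ (proj₂ (∈-words⁻ (2 + n) (suc n) v∈)) in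
         trans (cong (_∧ Q (suc n ∷ v)) (isAvoider-top v v≤1+n)) (∧-assoc (all (_<ᵇ suc n) v) _ _)) ⟩
  count (λ v → all (_<ᵇ suc n) v ∧ (isAvoider v ∧ Q (suc n ∷ v))) (words (2 + n) (suc n))
    ≡⟨ count-words-restrict (suc n) (λ v → isAvoider v ∧ Q (suc n ∷ v)) (n≤1+n (suc n)) ⟩
  countAvoiders (λ v → Q (suc n ∷ v)) (suc n)
    ∎
  where open ≡-Reasoning

count-after-rise : ∀ (Q : List ℕ → Bool) n →
  count (λ w → isAvoider (n ∷ suc n ∷ w) ∧ Q (n ∷ suc n ∷ w)) (words (2 + n) n) ≡
  countAvoiders (λ w → Q (n ∷ suc n ∷ w)) n
count-after-rise Q n = begin
  count (λ w → isAvoider (n ∷ suc n ∷ w) ∧ R w) (words (2 + n) n)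
    ≡⟨ count-cong (words (2 + n) n) (λ {w} _ →
         trans (cong (_∧ R w) (isAvoider-rise n w)) (∧-assoc (all (_<ᵇ n) w) _ _)) ⟩
  count (λ w → all (_<ᵇ n) w ∧ (isAvoider (suc n ∷ w) ∧ R w)) (words (2 + n) n)
    ≡⟨ count-words-restrict n (λ w → isAvoider (suc n ∷ w) ∧ R w) (m≤n+m n 2) ⟩
  count (λ w → isAvoider (suc n ∷ w) ∧ R w) (words n n)
    ≡⟨ count-cong (words n n) (λ {w} w∈ →
         cong (_∧ R w) (isAvoider-below (All.map m<n⇒m<1+n (proj₂ (∈-words⁻ n n w∈))))) ⟩
  countAvoiders R n
    ∎
  where
  open ≡-Reasoning
  R : List ℕ → Bool
  R w = Q (n ∷ suc n ∷ w)

countAvoiders-recurrence : ∀ (Q : List ℕ → Bool) n →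
  countAvoiders Q (2 + n) ≡
  countAvoiders (λ v → Q (suc n ∷ v)) (suc n) + countAvoiders (λ w → Q (n ∷ suc n ∷ w)) n
countAvoiders-recurrence Q n = begin
  countAvoiders Q (2 + n)                      ≡⟨ count-words-suc (2 + n) (suc n) P ⟩
  sum (map first (upTo (2 + n)))               ≡⟨ sum-upTo-last-two first n first-small ⟩
  first n + first (suc n)                      ≡⟨ +-comm (first n) _ ⟩
  first (suc n) + first n                      ≡⟨ cong₂ _+_ (count-after-max Q n) first-n ⟩
  countAvoiders (λ v → Q (suc n ∷ v)) (suc n) + countAvoiders (λ w → Q (n ∷ suc n ∷ w)) n ∎
  where
  open ≡-Reasoning
  P : List ℕ → Bool
  P w = isAvoider w ∧ Q w
  first : ℕ → ℕ
  first i = count (λ v → P (i ∷ v)) (words (2 + n) (suc n))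
  firstTwo : ℕ → ℕ → ℕ
  firstTwo i j = count (λ w → P (i ∷ j ∷ w)) (words (2 + n) n)

  firstTwo-zero : ∀ i j → (∀ {w} → length w ≡ n → ¬ T (isAvoider (i ∷ j ∷ w))) → firstTwo i j ≡ 0
  firstTwo-zero i j ¬avoider = count-zero (words (2 + n) n) λ {w} w∈ →
    cong (_∧ Q (i ∷ j ∷ w)) (¬T⇒≡false (¬avoider {w} (proj₁ (∈-words⁻ (2 + n) n w∈))))

  first-small : ∀ i → i < n → first i ≡ 0
  first-small i i<n =
    trans (count-words-suc (2 + n) n (λ v → P (i ∷ v)))
          (sum-upTo-zero (firstTwo i) (2 + n) λ j _ → firstTwo-zero i j λ {w} |w|≡n t →
             <⇒≱ i<n (subst (_≤ i) |w|≡n (isAvoider⇒length≤head {i} {j} {w} t)))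

  descent-zero : ∀ j → j ≤ n → firstTwo n j ≡ 0
  descent-zero j j≤n = firstTwo-zero n j λ {w} |w|≡n t →
    <-irrefl |w|≡n (isAvoider⇒length<head {n} {j} {w} t j≤n)

  first-n : first n ≡ countAvoiders (λ w → Q (n ∷ suc n ∷ w)) n
  first-n = begin
    first n                                ≡⟨ count-words-suc (2 + n) n (λ v → P (n ∷ v)) ⟩
    sum (map (firstTwo n) (upTo (2 + n)))  ≡⟨ sum-upTo-last-two (firstTwo n) n (λ j → descent-zero j ∘ <⇒≤) ⟩
    firstTwo n n + firstTwo n (suc n)      ≡⟨ cong (_+ firstTwo n (suc n)) (descent-zero n ≤-refl) ⟩
    firstTwo n (suc n)                     ≡⟨ count-after-rise Q n ⟩
    countAvoiders (λ w → Q (n ∷ suc n ∷ w)) n ∎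

desCount nonDesCount : ℕ → ℕ
desCount    = countAvoiders isDesarrangement
nonDesCount = countAvoiders (not ∘ isDesarrangement)

desCount-recurrence : ∀ n → desCount (2 + n) ≡ nonDesCount (suc n)
desCount-recurrence n = begin
  desCount (2 + n)
    ≡⟨ countAvoiders-recurrence isDesarrangement n ⟩
  countAvoiders (λ v → isDesarrangement (suc n ∷ v)) (suc n)
    + countAvoiders (λ w → isDesarrangement (n ∷ suc n ∷ w)) n
    ≡⟨ cong₂ _+_ (countAvoiders-cong (suc n) isDesarrangement-after-max)
                 (countAvoiders-cong n (λ {w} _ _ → isDesarrangement-ascent w (n<1+n n))) ⟩
  nonDesCount (suc n) + countAvoiders (λ _ → false) n
    ≡⟨ cong (nonDesCount (suc n) +_) (countAvoiders-false n) ⟩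
  nonDesCount (suc n) + 0
    ≡⟨ +-identityʳ _ ⟩
  nonDesCount (suc n)
    ∎
  where open ≡-Reasoning

nonDesCount-recurrence : ∀ n → nonDesCount (2 + n) ≡ desCount (suc n) + (desCount n + nonDesCount n)
nonDesCount-recurrence n = begin
  nonDesCount (2 + n)
    ≡⟨ countAvoiders-recurrence (not ∘ isDesarrangement) n ⟩
  countAvoiders (λ v → not (isDesarrangement (suc n ∷ v))) (suc n)
    + countAvoiders (λ w → not (isDesarrangement (n ∷ suc n ∷ w))) n
    ≡⟨ cong₂ _+_ (countAvoiders-cong (suc n) λ |v| v< →
                    trans (cong not (isDesarrangement-after-max |v| v<)) (not-involutive _))
                 (countAvoiders-cong n (λ {w} _ _ → cong not (isDesarrangement-ascent w (n<1+n n)))) ⟩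
  desCount (suc n) + countAvoiders (λ _ → true) n
    ≡⟨ cong (desCount (suc n) +_) (countAvoiders-split isDesarrangement n) ⟩
  desCount (suc n) + (desCount n + nonDesCount n)
    ∎
  where open ≡-Reasoning

counts-fib : ∀ n → desCount (suc n) ≡ fib n × nonDesCount (suc n) ≡ fib (suc n)
counts-fib 0 = refl , refl
counts-fib 1 = refl , refl
counts-fib (suc (suc n)) with d₁ , n₁ ← counts-fib n | d₂ , n₂ ← counts-fib (suc n) =
  trans (desCount-recurrence (suc n)) n₂ , (begin
    nonDesCount (3 + n)
      ≡⟨ nonDesCount-recurrence (suc n) ⟩
    desCount (2 + n) + (desCount (suc n) + nonDesCount (suc n))
      ≡⟨ cong₂ _+_ d₂ (cong₂ _+_ d₁ n₁) ⟩
    fib (suc n) + (fib n + fib (suc n))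
      ≡⟨ +-assoc (fib (suc n)) (fib n) _ ⟨
    fib (3 + n)
      ∎)
  where open ≡-Reasoning

d≡desCount : ∀ m → d m Π ≡ desCount m
d≡desCount m =
  trans (count-boolFilter _ distinct (words m m))
        (count-cong (words m m) (λ {π} _ → regroup (distinct π) (isDesarrangement π) (avoidsΠ π)))
  where
  regroup : ∀ a b c → a ∧ (b ∧ c) ≡ (a ∧ c) ∧ b
  regroup = solve 3 (λ a b c → a :* (b :* c) := (a :* c) :* b) refl
    where open ∨-∧-Solver

theorem3p26 : (n : ℕ) → d (suc n) ((1 ∷ 2 ∷ 3 ∷ []) ∷ (1 ∷ 3 ∷ 2 ∷ []) ∷ (2 ∷ 1 ∷ 3 ∷ []) ∷ []) ≡ fib n
theorem3p26 n = trans (d≡desCount (suc n)) (proj₁ (counts-fib n))
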